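{- Let $x=[0;a_1,a_2,\dots]$ have infinite continued fraction expansion with positive integer partial quotients. (i) If $x\in T_2$, then either $a_2=4$ or $a_2=2^l-3$ for some integer $l\geq 3$. (ii) If $x\in T_3$, then necessarily $a_2=1$.
   Context: A real number $x$ is a Trott number in base $b$ if $x\in(0,1)$ has an infinite continued fraction expansion $x=[0;a_1,a_2,\dots]$ with all $a_i$ positive integers and the base-$b$ expansion of $x$ is $(0.\hat{a}_1\hat{a}_2\hat{a}_3\dots)_b$, where $\hat{a}_i$ is the string of base-$b$ digits of $a_i$ (without leading zeros), concatenated. $T_b$ is the set of Trott numbers in base $b$. -}

module Defs where

open import Data.Nat using (ℕ; zero; suc; _+_; _*_; _^_; _≤_; _<ᵇ_)
open import Data.Bool using (if_then_else_)
open import Data.Product using (_×_; _,_)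
open import Data.Sum using (_⊎_)

-- A continued fraction [0; a₁, a₂, …] is represented by a : ℕ → ℕ with
-- a i = a_{i+1}  (so a 0 = a₁, a 1 = a₂, …).  All partial quotients positive:
PositiveCF : (ℕ → ℕ) → Set
PositiveCF a = ∀ i → 1 ≤ a i

-- Number of base-b digits of m (m ≥ 1, b ≥ 2): least L with m < b ^ L.
-- Search L = 0,1,…; fuel (suc m) suffices since m < b ^ m for b ≥ 2.
ndigitsFrom : ℕ → ℕ → ℕ → ℕ → ℕ
ndigitsFrom b m zero     L = L
ndigitsFrom b m (suc f)  L = if m <ᵇ b ^ L then L else ndigitsFrom b m f (suc L)

ndigits : ℕ → ℕ → ℕ
ndigits b m = ndigitsFrom b m (suc m) 0

-- Concatenation of the base-b digit strings of a₁,…,aₙ, read as a natural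
-- number V together with its length L (number of digits).  Then
-- 0.â₁â₂…âₙ (base b) = V / b ^ L.
concatDigits : ℕ → (ℕ → ℕ) → ℕ → ℕ × ℕ
concatDigits b a zero    = 0 , 0
concatDigits b a (suc n) with concatDigits b a n
... | V , L = V * b ^ ndigits b (a n) + a n , L + ndigits b (a n)

-- Convergents p_n / q_n of [0; a₁, a₂, …]:
-- cfPQ a n = (p_{n-1}, q_{n-1}, p_n, q_n), with p_{-1}=1, q_{-1}=0, p₀=0, q₀=1.
record PQ : Set where
  constructor pq
  field p' q' p q : ℕ

cfPQ : (ℕ → ℕ) → ℕ → PQ
cfPQ a zero = pq 1 0 0 1
cfPQ a (suc n) with cfPQ a n
... | pq p' q' p q = pq p q (a n * p + p') (a n * q + q')

-- The value x of the continued fraction lies, for every n, in the closed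
-- interval between the convergents p_n/q_n and p_{n+1}/q_{n+1}.
-- The real number (0.â₁â₂…)_b lies, for every k, in the closed interval
-- [V_k / b^L_k , (V_k + 1) / b^L_k].  Both families are nested with lengths
-- tending to 0, so the two reals coincide iff every interval of the first
-- family meets every interval of the second.
_/_≤ℚ_/_ : ℕ → ℕ → ℕ → ℕ → Set
(m / n ≤ℚ k / l) = m * l ≤ k * n

Meets : ℕ → (ℕ → ℕ) → ℕ → ℕ → Set
Meets b a n k with cfPQ a n | cfPQ a (suc n) | concatDigits b a k
... | pq _ _ p q | pq _ _ p₁ q₁ | V , L =
  -- min(c_n, c_{n+1}) ≤ (V+1)/b^L
  ((p / q ≤ℚ (V + 1) / (b ^ L)) ⊎ (p₁ / q₁ ≤ℚ (V + 1) / (b ^ L)))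
  -- V/b^L ≤ max(c_n, c_{n+1})
  × ((V / (b ^ L) ≤ℚ p / q) ⊎ (V / (b ^ L) ≤ℚ p₁ / q₁))

-- x = [0; a₁, a₂, …] is a Trott number in base b: its base-b expansion is
-- (0.â₁â₂â₃…)_b, i.e. x equals the real number with that expansion.
Trott : ℕ → (ℕ → ℕ) → Set
Trott b a = ∀ n k → Meets b a n k

{-# OPTIONS --safe #-}
-- Indices follow Defs: x = [0; a₀, a₁, …] with convergents cₙ = pₙ / qₙ, and Jₖ is
-- the interval [Vₖ, Vₖ + 1] / b^Lₖ of reals whose expansion starts with â₀…âₖ₋₁.
-- A Trott number lies in every Jₖ and between any two consecutive convergents.
--
-- From J₂ ∋ x ≤ c₁ = 1/a₀ we get a₀² < b^|â₀| ≤ a₀ b, so a₀ is a digit and a₀² < b;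
-- in bases 2 and 3 this forces a₀ = 1.  In base 2, put N = 2^|â₁| ≤ 2 a₁: then
-- c₂ = a₁/(a₁+1) ≤ sup J₂ = (N + a₁ + 1)/2N and inf J₃ ≥ (2(N + a₁) + 1)/4N, while
-- x ≤ c₃ ≤ [0; 1, a₁ + 1].  These two inequalities leave only the gaps N − a₁ = 3
-- and N − a₁ = 4 with a₁ ∈ {4, 5}, and 9 is not a power of 2.  In base 3,
-- sup J₂ ≤ 2/3 ≤ c₂ when a₁ ≥ 2, contradicting x ≥ c₄ > c₂.
module Submission where

open import Defs
open import Data.Nat using (ℕ; _+_; _^_; _∸_; _≤_)
open import Data.Product using (_×_; ∃)
open import Data.Sum using (_⊎_)
open import Relation.Binary.PropositionalEquality using (_≡_)

open import Data.Bool.Base using (true; false)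
open import Data.Nat.Base using (zero; suc; _*_; _<_; _<ᵇ_; z≤n; s≤s; z<s; >-nonZero)
open import Data.Nat.Divisibility using (_∣_; _∣?_; m∣m*n)
open import Data.Nat.Properties
open import Data.Nat.Tactic.RingSolver using (solve-∀)
open import Data.Product using (_,_; proj₁; proj₂)
open import Data.Sum using (inj₁; inj₂; [_,_]′; swap)
open import Function.Base using (id; _∘_)
open import Relation.Binary.PropositionalEquality using (refl; sym; trans; cong; cong₂; subst; subst₂; _≢_; module ≡-Reasoning)
open import Relation.Nullary using (¬_; contradiction; ofʸ; ofⁿ; yes; no)
open import Relation.Nullary.Decidable using (from-no)

variable
  a : ℕ → ℕ
  b m n k l x : ℕ

n<bⁿ : 1 < b → ∀ n → n < b ^ n
n<bⁿ 1<b zero    = z<s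
n<bⁿ {b} 1<b (suc n) = ≤-<-trans (n<bⁿ 1<b n) (^-monoʳ-< b 1<b (n<1+n n))

ndigitsFrom-bounds : ∀ f d → b ^ d ≤ m * b → m < b ^ (f + d) →
                     b ^ ndigitsFrom b m f d ≤ m * b × m < b ^ ndigitsFrom b m f d
ndigitsFrom-bounds zero d lower upper = lower , upper
ndigitsFrom-bounds {b} {m} (suc f) d lower upper with m <ᵇ b ^ d | <ᵇ-reflects-< m (b ^ d)
... | true  | ofʸ m<bᵈ = lower , m<bᵈ
... | false | ofⁿ m≮bᵈ =
  ndigitsFrom-bounds f (suc d) lower′ (subst (λ e → m < b ^ e) (sym (+-suc f d)) upper)
  where
    lower′ : b ^ suc d ≤ m * b
    lower′ = subst (b ^ suc d ≤_) (*-comm b m) (*-monoʳ-≤ b (≮⇒≥ m≮bᵈ))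

ndigits-bounds : 1 < b → 1 ≤ m → b ^ ndigits b m ≤ m * b × m < b ^ ndigits b m
ndigits-bounds {b} {m} 1<b 1≤m = ndigitsFrom-bounds (suc m) 0 (*-mono-≤ 1≤m (<⇒≤ 1<b)) m<bᵐ⁺¹
  where
    m<bᵐ⁺¹ : m < b ^ (suc m + 0)
    m<bᵐ⁺¹ = subst (λ e → m < b ^ e) (sym (+-identityʳ (suc m)))
                   (<-trans (n<1+n m) (n<bⁿ 1<b (suc m)))

ndigits-digit : 1 < b → 1 ≤ m → m < b → ndigits b m ≡ 1
ndigits-digit {b} {m} 1<b@(s≤s (s≤s _)) 1≤m m<b with ndigits b m | ndigits-bounds 1<b 1≤m
... | zero        | _ , m<1      = contradiction 1≤m (<⇒≱ m<1)
... | suc zero    | _            = refl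
... | suc (suc d) | bᵈ⁺²≤mb , _ =
  contradiction (≤-<-trans bᵈ⁺²≤mb (*-monoˡ-< b m<b)) (≤⇒≯ b²≤bᵈ⁺²)
  where
    b²≤bᵈ⁺² : b * b ≤ b ^ (2 + d)
    b²≤bᵈ⁺² = *-monoʳ-≤ b (≤-trans (≤-reflexive (sym (*-identityʳ b))) (*-monoʳ-≤ b (m^n>0 b d)))

≤ℚ-trans : ∀ m₁ n₁ m₂ n₂ m₃ n₃ → 0 < n₂ →
           m₁ / n₁ ≤ℚ m₂ / n₂ → m₂ / n₂ ≤ℚ m₃ / n₃ → m₁ / n₁ ≤ℚ m₃ / n₃
≤ℚ-trans m₁ n₁ m₂ n₂ m₃ n₃ n₂>0 h₁ h₂ =
  *-cancelʳ-≤ (m₁ * n₃) (m₃ * n₁) n₂ {{>-nonZero n₂>0}} (begin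
    m₁ * n₃ * n₂ ≡⟨ swap₂₃ m₁ n₃ n₂ ⟩
    m₁ * n₂ * n₃ ≤⟨ *-monoˡ-≤ n₃ h₁ ⟩
    m₂ * n₁ * n₃ ≡⟨ swap₂₃ m₂ n₁ n₃ ⟩
    m₂ * n₃ * n₁ ≤⟨ *-monoˡ-≤ n₁ h₂ ⟩
    m₃ * n₂ * n₁ ≡⟨ swap₂₃ m₃ n₂ n₁ ⟩
    m₃ * n₁ * n₂ ∎)
  where
    open ≤-Reasoning
    swap₂₃ : ∀ x y z → x * y * z ≡ x * z * y
    swap₂₃ = solve-∀

≤ℚ-subst : ∀ {m′ n′ k′ l′} → m ≡ m′ → n ≡ n′ → k ≡ k′ → l ≡ l′ →
           m / n ≤ℚ k / l → m′ / n′ ≤ℚ k′ / l′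
≤ℚ-subst refl refl refl refl h = h

min-≤ℚ : ∀ m₁ n₁ m₂ n₂ k l → 0 < n₂ → m₁ / n₁ ≤ℚ m₂ / n₂ →
         (m₁ / n₁ ≤ℚ k / l) ⊎ (m₂ / n₂ ≤ℚ k / l) → m₁ / n₁ ≤ℚ k / l
min-≤ℚ m₁ n₁ m₂ n₂ k l n₂>0 h = [ id , ≤ℚ-trans m₁ n₁ m₂ n₂ k l n₂>0 h ]′

≤ℚ-max : ∀ k l m₁ n₁ m₂ n₂ → 0 < n₁ → m₁ / n₁ ≤ℚ m₂ / n₂ →
         (k / l ≤ℚ m₁ / n₁) ⊎ (k / l ≤ℚ m₂ / n₂) → k / l ≤ℚ m₂ / n₂
≤ℚ-max k l m₁ n₁ m₂ n₂ n₁>0 h = [ (λ h′ → ≤ℚ-trans k l m₁ n₁ m₂ n₂ n₁>0 h′ h) , id ]′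

record _/_⋖_/_ (m n k l : ℕ) : Set where
  constructor ⋖-det
  field det : m * l + 1 ≡ k * n

⋖⇒≤ℚ : m / n ⋖ k / l → m / n ≤ℚ k / l
⋖⇒≤ℚ {m} {n} {k} {l} (⋖-det det) = subst (m * l ≤_) det (m≤m+n (m * l) 1)

⋖-mediantˡ : ∀ c → m / n ⋖ k / l → (c * k + m) / (c * l + n) ⋖ k / l
⋖-mediantˡ {m} {n} {k} {l} c (⋖-det det) = ⋖-det (begin
    (c * k + m) * l + 1     ≡⟨ E₁ c k m l ⟩
    c * k * l + (m * l + 1) ≡⟨ cong (c * k * l +_) det ⟩
    c * k * l + k * n       ≡⟨ E₂ c k l n ⟩
    k * (c * l + n)         ∎)
  where
    open ≡-Reasoning
    E₁ : ∀ c k m l → (c * k + m) * l + 1 ≡ c * k * l + (m * l + 1)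
    E₁ = solve-∀
    E₂ : ∀ c k l n → c * k * l + k * n ≡ k * (c * l + n)
    E₂ = solve-∀

⋖-mediantʳ : ∀ c → k / l ⋖ m / n → k / l ⋖ (c * k + m) / (c * l + n)
⋖-mediantʳ {k} {l} {m} {n} c (⋖-det det) = ⋖-det (begin
    k * (c * l + n) + 1     ≡⟨ E₁ c k l n ⟩
    c * k * l + (k * n + 1) ≡⟨ cong (c * k * l +_) det ⟩
    c * k * l + m * l       ≡⟨ E₂ c k l m ⟩
    (c * k + m) * l         ∎)
  where
    open ≡-Reasoning
    E₁ : ∀ c k l n → k * (c * l + n) + 1 ≡ c * k * l + (k * n + 1)
    E₁ = solve-∀
    E₂ : ∀ c k l m → c * k * l + m * l ≡ (c * k + m) * l
    E₂ = solve-∀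

⋖-mediant-≰ : ∀ {c} → m / n ⋖ k / l → 1 ≤ c → ¬ ((c * k + m) / (c * l + n) ≤ℚ m / n)
⋖-mediant-≰ {m} {n} {k} {l} {c} (⋖-det det) 1≤c = <⇒≱ (begin-strict
    m * (c * l + n)          ≡⟨ E₁ m c l n ⟩
    c * (m * l) + m * n + 0  <⟨ +-monoʳ-< (c * (m * l) + m * n) 1≤c ⟩
    c * (m * l) + m * n + c  ≡⟨ E₂ c m l n ⟩
    c * (m * l + 1) + m * n  ≡⟨ cong (λ t → c * t + m * n) det ⟩
    c * (k * n) + m * n      ≡⟨ E₃ c k n m ⟩
    (c * k + m) * n          ∎)
  where
    open ≤-Reasoning
    E₁ : ∀ m c l n → m * (c * l + n) ≡ c * (m * l) + m * n + 0
    E₁ = solve-∀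
    E₂ : ∀ c m l n → c * (m * l) + m * n + c ≡ c * (m * l + 1) + m * n
    E₂ = solve-∀
    E₃ : ∀ c k n m → c * (k * n) + m * n ≡ (c * k + m) * n
    E₃ = solve-∀

⋖-mediant-≤ : ∀ {c} → m / n ⋖ k / l → 1 ≤ c → (c * m + k) / (c * n + l) ≤ℚ (m + k) / (n + l)
⋖-mediant-≤ {m} {n} {k} {l} {c} (⋖-det det) 1≤c = begin
    (c * m + k) * (n + l)                      ≡⟨ E₁ c m k n l ⟩
    c * m * n + k * l + c * (m * l) + k * n    ≡⟨ cong (c * m * n + k * l + c * (m * l) +_) (sym det) ⟩
    c * m * n + k * l + c * (m * l) + (m * l + 1) ≡⟨ E₂ c m n k l ⟩
    c * m * n + k * l + m * l + c * (m * l) + 1 ≤⟨ +-monoʳ-≤ (c * m * n + k * l + m * l + c * (m * l)) 1≤c ⟩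
    c * m * n + k * l + m * l + c * (m * l) + c ≡⟨ E₃ c m n k l ⟩
    c * m * n + k * l + m * l + c * (m * l + 1) ≡⟨ cong (λ t → c * m * n + k * l + m * l + c * t) det ⟩
    c * m * n + k * l + m * l + c * (k * n)     ≡⟨ E₄ c m n k l ⟩
    (m + k) * (c * n + l)                      ∎
  where
    open ≤-Reasoning
    E₁ : ∀ c m k n l → (c * m + k) * (n + l) ≡ c * m * n + k * l + c * (m * l) + k * n
    E₁ = solve-∀
    E₂ : ∀ c m n k l → c * m * n + k * l + c * (m * l) + (m * l + 1) ≡ c * m * n + k * l + m * l + c * (m * l) + 1
    E₂ = solve-∀
    E₃ : ∀ c m n k l → c * m * n + k * l + m * l + c * (m * l) + c ≡ c * m * n + k * l + m * l + c * (m * l + 1)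
    E₃ = solve-∀
    E₄ : ∀ c m n k l → c * m * n + k * l + m * l + c * (k * n) ≡ (m + k) * (c * n + l)
    E₄ = solve-∀

p q : (ℕ → ℕ) → ℕ → ℕ
p a n = PQ.p (cfPQ a n)
q a n = PQ.q (cfPQ a n)

q-pos : PositiveCF a → ∀ n → 0 < q a n
q-pos pos zero          = z<s
q-pos {a} pos (suc n)   = ≤-trans (*-mono-≤ (pos n) (q-pos pos n)) (m≤m+n (a n * q a n) _)

Zigzag : (ℕ → ℕ) → ℕ → Set
Zigzag a i = p a i / q a i ⋖ p a (1 + i) / q a (1 + i) ×
             p a (2 + i) / q a (2 + i) ⋖ p a (1 + i) / q a (1 + i)

zigzag-step : ∀ i → Zigzag a i → Zigzag a (2 + i)
zigzag-step {a} i (_ , c₂₊ᵢ⋖c₁₊ᵢ) = c₂₊ᵢ⋖c₃₊ᵢ , ⋖-mediantˡ (a (3 + i)) c₂₊ᵢ⋖c₃₊ᵢ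
  where
    c₂₊ᵢ⋖c₃₊ᵢ : p a (2 + i) / q a (2 + i) ⋖ p a (3 + i) / q a (3 + i)
    c₂₊ᵢ⋖c₃₊ᵢ = ⋖-mediantʳ (a (2 + i)) c₂₊ᵢ⋖c₁₊ᵢ

convergents-zigzag : ∀ a j → Zigzag a (2 * j)
convergents-zigzag a zero = c₀⋖c₁ , ⋖-mediantˡ (a 1) c₀⋖c₁
  where
    c₀⋖c₁ : 0 / 1 ⋖ p a 1 / q a 1
    c₀⋖c₁ = ⋖-det (sym (trans (*-identityʳ _) (cong (_+ 1) (*-zeroʳ (a 0)))))
convergents-zigzag a (suc j) =
  subst (Zigzag a) (sym (*-suc 2 j)) (zigzag-step (2 * j) (convergents-zigzag a j))

V L : ℕ → (ℕ → ℕ) → ℕ → ℕ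
V b a k = proj₁ (concatDigits b a k)
L b a k = proj₂ (concatDigits b a k)

digits-append-≥ : 1 < b → PositiveCF a → ∀ k →
  (b * V b a k + 1) / (b * b ^ L b a k) ≤ℚ V b a (suc k) / (b ^ L b a (suc k))
digits-append-≥ {b} {a} 1<b pos k = begin
    (b * v + 1) * b ^ (L b a k + d)   ≡⟨ cong ((b * v + 1) *_) (^-distribˡ-+-* b (L b a k) d) ⟩
    (b * v + 1) * (B * D)             ≡⟨ E₁ b v B D ⟩
    b * v * (B * D) + B * D           ≤⟨ +-monoʳ-≤ (b * v * (B * D)) (*-monoʳ-≤ B D≤aₖb) ⟩
    b * v * (B * D) + B * (a k * b)   ≡⟨ E₂ b v B D (a k) ⟩
    (v * D + a k) * (b * B)           ∎
  where
    open ≤-Reasoning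
    v d B D : ℕ
    v = V b a k
    d = ndigits b (a k)
    B = b ^ L b a k
    D = b ^ d
    D≤aₖb : D ≤ a k * b
    D≤aₖb = proj₁ (ndigits-bounds 1<b (pos k))
    E₁ : ∀ b v B D → (b * v + 1) * (B * D) ≡ b * v * (B * D) + B * D
    E₁ = solve-∀
    E₂ : ∀ b v B D x → b * v * (B * D) + B * (x * b) ≡ (v * D + x) * (b * B)
    E₂ = solve-∀

meets-rising : ∀ b n k → PositiveCF a → Trott b a → p a n / q a n ⋖ p a (suc n) / q a (suc n) →
  p a n / q a n ≤ℚ (V b a k + 1) / (b ^ L b a k) ×
  V b a k / (b ^ L b a k) ≤ℚ p a (suc n) / q a (suc n)
meets-rising {a} b n k pos trott cₙ⋖cₙ₊₁ with trott n k
... | upper , lower =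
  min-≤ℚ (p a n) (q a n) (p a (suc n)) (q a (suc n)) (V b a k + 1) (b ^ L b a k)
         (q-pos pos (suc n)) (⋖⇒≤ℚ cₙ⋖cₙ₊₁) upper ,
  ≤ℚ-max (V b a k) (b ^ L b a k) (p a n) (q a n) (p a (suc n)) (q a (suc n))
         (q-pos pos n) (⋖⇒≤ℚ cₙ⋖cₙ₊₁) lower

meets-falling : ∀ b n k → PositiveCF a → Trott b a → p a (suc n) / q a (suc n) ⋖ p a n / q a n →
  p a (suc n) / q a (suc n) ≤ℚ (V b a k + 1) / (b ^ L b a k) ×
  V b a k / (b ^ L b a k) ≤ℚ p a n / q a n
meets-falling {a} b n k pos trott cₙ₊₁⋖cₙ with trott n k
... | upper , lower =
  min-≤ℚ (p a (suc n)) (q a (suc n)) (p a n) (q a n) (V b a k + 1) (b ^ L b a k)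
         (q-pos pos n) (⋖⇒≤ℚ cₙ₊₁⋖cₙ) (swap upper) ,
  ≤ℚ-max (V b a k) (b ^ L b a k) (p a (suc n)) (q a (suc n)) (p a n) (q a n)
         (q-pos pos (suc n)) (⋖⇒≤ℚ cₙ₊₁⋖cₙ) (swap lower)

p₁≡1 : ∀ a → p a 1 ≡ 1
p₁≡1 a = cong (_+ 1) (*-zeroʳ (a 0))

q₁≡a₀ : ∀ a → q a 1 ≡ a 0
q₁≡a₀ a = trans (+-identityʳ _) (*-identityʳ (a 0))

p₂≡a₁ : ∀ a → p a 2 ≡ a 1
p₂≡a₁ a = trans (+-identityʳ _) (trans (cong (a 1 *_) (p₁≡1 a)) (*-identityʳ (a 1)))

first-quotient²<bᵈ : ∀ b → PositiveCF a → Trott b a → a 0 * a 0 < b ^ ndigits b (a 0)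
first-quotient²<bᵈ {a} b pos trott = *-cancelʳ-< D (a 0 * a 0) B (begin-strict
    a 0 * a 0 * D              ≡⟨ E (a 0) D ⟩
    a 0 * D * a 0 + 0          <⟨ +-monoʳ-< (a 0 * D * a 0) (*-mono-≤ (pos 1) (pos 0)) ⟩
    a 0 * D * a 0 + a 1 * a 0  ≡⟨ sym (*-distribʳ-+ (a 0) (a 0 * D) (a 1)) ⟩
    (a 0 * D + a 1) * a 0      ≡⟨ cong ((a 0 * D + a 1) *_) (sym (q₁≡a₀ a)) ⟩
    (a 0 * D + a 1) * q a 1    ≤⟨ x≤c₁ ⟩
    p a 1 * b ^ (d + ndigits b (a 1)) ≡⟨ cong (_* b ^ (d + ndigits b (a 1))) (p₁≡1 a) ⟩
    1 * b ^ (d + ndigits b (a 1))     ≡⟨ *-identityˡ _ ⟩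
    b ^ (d + ndigits b (a 1))  ≡⟨ ^-distribˡ-+-* b d (ndigits b (a 1)) ⟩
    B * D                      ∎)
  where
    open ≤-Reasoning
    d B D : ℕ
    d = ndigits b (a 0)
    B = b ^ d
    D = b ^ ndigits b (a 1)
    x≤c₁ : V b a 2 / (b ^ L b a 2) ≤ℚ p a 1 / q a 1
    x≤c₁ = proj₂ (meets-falling b 1 2 pos trott (proj₂ (convergents-zigzag a 0)))
    E : ∀ x D → x * x * D ≡ x * D * x + 0
    E = solve-∀

first-quotient²<base : 1 < b → PositiveCF a → Trott b a → a 0 * a 0 < b
first-quotient²<base {b} {a} 1<b pos trott = subst (a 0 * a 0 <_) bᵈ≡b a₀²<bᵈ
  where
    a₀²<bᵈ : a 0 * a 0 < b ^ ndigits b (a 0)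
    a₀²<bᵈ = first-quotient²<bᵈ b pos trott
    a₀<b : a 0 < b
    a₀<b = *-cancelˡ-< (a 0) (a 0) b (<-≤-trans a₀²<bᵈ (proj₁ (ndigits-bounds 1<b (pos 0))))
    bᵈ≡b : b ^ ndigits b (a 0) ≡ b
    bᵈ≡b = trans (cong (b ^_) (ndigits-digit 1<b (pos 0) a₀<b)) (*-identityʳ b)

square<4⇒≡1 : 1 ≤ x → x * x < 4 → x ≡ 1
square<4⇒≡1 1≤x x²<4 = ≤-antisym (≮⇒≥ λ 1<x → <⇒≱ x²<4 (*-mono-≤ 1<x 1<x)) 1≤x

first-quotient≡1 : 1 < b → b ≤ 3 → PositiveCF a → Trott b a → a 0 ≡ 1
first-quotient≡1 1<b b≤3 pos trott =
  square<4⇒≡1 (pos 0) (<-trans (first-quotient²<base 1<b pos trott) (s≤s b≤3))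

module FirstQuotientOne (a : ℕ → ℕ) (a₀≡1 : a 0 ≡ 1) where

  q₂≡a₁+1 : q a 2 ≡ a 1 + 1
  q₂≡a₁+1 = trans (cong (λ z → a 1 * z + 1) (trans (q₁≡a₀ a) a₀≡1)) (cong (_+ 1) (*-identityʳ (a 1)))

  V₂≡ : ∀ b → V b a 2 ≡ b ^ ndigits b (a 1) + a 1
  V₂≡ b = trans (cong (λ z → z * b ^ ndigits b (a 1) + a 1) a₀≡1) (cong (_+ a 1) (*-identityˡ _))

  bᴸ²≡ : 1 < b → b ^ L b a 2 ≡ b * b ^ ndigits b (a 1)
  bᴸ²≡ {b} (s≤s (s≤s _)) = cong (λ z → b ^ (ndigits b z + ndigits b (a 1))) a₀≡1

trott₂-bounds : PositiveCF a → Trott 2 a → a 0 ≡ 1 →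
  let x = a 1 ; N = 2 ^ ndigits 2 (a 1) in
  x / (x + 1) ≤ℚ (N + x + 1) / (2 * N) ×
  (2 * (N + x) + 1) / (2 * (2 * N)) ≤ℚ (x + 1) / (x + 2)
trott₂-bounds {a} pos trott a₀≡1 = c₂≤supJ₂ , infJ₃≤mediant
  where
    open FirstQuotientOne a a₀≡1
    N : ℕ
    N = 2 ^ ndigits 2 (a 1)
    c₂⋖c₁ : p a 2 / q a 2 ⋖ p a 1 / q a 1
    c₂⋖c₁ = proj₂ (convergents-zigzag a 0)
    c₂⋖c₃ : p a 2 / q a 2 ⋖ p a 3 / q a 3
    c₂⋖c₃ = proj₁ (convergents-zigzag a 1)
    c₂≤supJ₂ : a 1 / (a 1 + 1) ≤ℚ (N + a 1 + 1) / (2 * N)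
    c₂≤supJ₂ = ≤ℚ-subst (p₂≡a₁ a) q₂≡a₁+1 (cong (_+ 1) (V₂≡ 2)) (bᴸ²≡ ≤-refl)
                 (proj₁ (meets-rising 2 2 2 pos trott c₂⋖c₃))
    q₂+q₁≡ : q a 2 + q a 1 ≡ a 1 + 2
    q₂+q₁≡ = trans (cong₂ _+_ q₂≡a₁+1 (trans (q₁≡a₀ a) a₀≡1)) (+-assoc (a 1) 1 1)
    infJ₃≤mediant : (2 * (N + a 1) + 1) / (2 * (2 * N)) ≤ℚ (a 1 + 1) / (a 1 + 2)
    infJ₃≤mediant = ≤ℚ-subst (cong (λ v → 2 * v + 1) (V₂≡ 2)) (cong (2 *_) (bᴸ²≡ ≤-refl))
                      (cong₂ _+_ (p₂≡a₁ a) (p₁≡1 a)) q₂+q₁≡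
      (≤ℚ-trans (2 * V 2 a 2 + 1) (2 * 2 ^ L 2 a 2) (V 2 a 3) (2 ^ L 2 a 3) (p a 2 + p a 1) (q a 2 + q a 1)
         (m^n>0 2 (L 2 a 3)) (digits-append-≥ ≤-refl pos 2)
         (≤ℚ-trans (V 2 a 3) (2 ^ L 2 a 3) (p a 3) (q a 3) (p a 2 + p a 1) (q a 2 + q a 1)
            (q-pos pos 3) (proj₂ (meets-rising 2 2 3 pos trott c₂⋖c₃)) (⋖-mediant-≤ c₂⋖c₁ (pos 2))))

gap-upper : ∀ x m → x / (x + 1) ≤ℚ (x + m + x + 1) / (2 * (x + m)) → x * m ≤ 3 * x + m + 1
gap-upper x m h = +-cancelˡ-≤ C (x * m) (3 * x + m + 1) (subst₂ _≤_ (E₁ x m) (E₂ x m) h)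
  where
    C : ℕ
    C = 2 * x * x + x * m
    E₁ : ∀ x m → x * (2 * (x + m)) ≡ 2 * x * x + x * m + x * m
    E₁ = solve-∀
    E₂ : ∀ x m → (x + m + x + 1) * (x + 1) ≡ 2 * x * x + x * m + (3 * x + m + 1)
    E₂ = solve-∀

gap-lower : ∀ x m → (2 * (x + m + x) + 1) / (2 * (2 * (x + m))) ≤ℚ (x + 1) / (x + 2) → 5 * x + 2 ≤ 2 * x * m
gap-lower x m h = +-cancelˡ-≤ C (5 * x + 2) (2 * x * m) (subst₂ _≤_ (E₁ x m) (E₂ x m) h)
  where
    C : ℕ
    C = 4 * x * x + 4 * x + 2 * x * m + 4 * m
    E₁ : ∀ x m → (2 * (x + m + x) + 1) * (x + 2) ≡ 4 * x * x + 4 * x + 2 * x * m + 4 * m + (5 * x + 2)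
    E₁ = solve-∀
    E₂ : ∀ x m → (x + 1) * (2 * (2 * (x + m))) ≡ 4 * x * x + 4 * x + 2 * x * m + 4 * m + 2 * x * m
    E₂ = solve-∀

small-gap : ∀ x m → m ≤ 2 → 2 * x * m < 5 * x + 2
small-gap x m m≤2 = begin-strict
    2 * x * m  ≤⟨ *-monoʳ-≤ (2 * x) m≤2 ⟩
    2 * x * 2  ≡⟨ E x ⟩
    4 * x      ≤⟨ *-monoˡ-≤ x (n≤1+n 4) ⟩
    5 * x      <⟨ m<m+n (5 * x) z<s ⟩
    5 * x + 2  ∎
  where
    open ≤-Reasoning
    E : ∀ x → 2 * x * 2 ≡ 4 * x
    E = solve-∀

gap-cases : 1 ≤ m → m ≤ x → x * m ≤ 3 * x + m + 1 → 5 * x + 2 ≤ 2 * x * m →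
            m ≡ 3 ⊎ x ≡ 4 ⊎ (x ≡ 5 × m ≡ 4)
gap-cases {zero} () _ _ _
gap-cases {1} {x} _ _ _ lower = contradiction lower (<⇒≱ (small-gap x 1 (s≤s z≤n)))
gap-cases {2} {x} _ _ _ lower = contradiction lower (<⇒≱ (small-gap x 2 (s≤s (s≤s z≤n))))
gap-cases {3} _ _ _ _ = inj₁ refl
gap-cases {4} {x} _ 4≤x upper _ with x ≟ 4
... | yes x≡4 = inj₂ (inj₁ x≡4)
... | no x≢4  = inj₂ (inj₂ (≤-antisym x≤5 (≤∧≢⇒< 4≤x (x≢4 ∘ sym)) , refl))
  where
    E : ∀ x → x * 4 ≡ 3 * x + x
    E = solve-∀
    x≤5 : x ≤ 5
    x≤5 = +-cancelˡ-≤ (3 * x) x 5 (subst₂ _≤_ (E x) (+-assoc (3 * x) 4 1) upper)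
gap-cases {m@(suc (suc (suc (suc (suc _)))))} {x} _ m≤x upper _ = contradiction upper (<⇒≱ (begin-strict
    3 * x + m + 1  <⟨ +-monoʳ-< (3 * x + m) (s≤s (s≤s z≤n)) ⟩
    3 * x + m + m  ≤⟨ +-mono-≤ (+-monoʳ-≤ (3 * x) m≤x) m≤x ⟩
    3 * x + x + x  ≡⟨ E x ⟩
    x * 5          ≤⟨ *-monoʳ-≤ x (s≤s (s≤s (s≤s (s≤s (s≤s z≤n))))) ⟩
    x * m          ∎))
  where
    open ≤-Reasoning
    E : ∀ x → 3 * x + x + x ≡ x * 5
    E = solve-∀

base₂-arith : ∀ {x N} → x < N → N ≤ x * 2 →
  x / (x + 1) ≤ℚ (N + x + 1) / (2 * N) →
  (2 * (N + x) + 1) / (2 * (2 * N)) ≤ℚ (x + 1) / (x + 2) →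
  (3 ≤ x × N ≡ 3 + x) ⊎ x ≡ 4 ⊎ N ≡ 9
base₂-arith {x} x<N N≤2x upper lower with m≤n⇒∃[o]m+o≡n (<⇒≤ x<N)
... | m , refl = from-gap (gap-cases 1≤m m≤x (gap-upper x m upper) (gap-lower x m lower))
  where
    1≤m : 1 ≤ m
    1≤m = +-cancelˡ-≤ x 1 m (subst (_≤ x + m) (+-comm 1 x) x<N)
    m≤x : m ≤ x
    m≤x = +-cancelˡ-≤ x m x (subst (x + m ≤_) (trans (*-comm x 2) (cong (x +_) (+-identityʳ x))) N≤2x)
    from-gap : m ≡ 3 ⊎ x ≡ 4 ⊎ (x ≡ 5 × m ≡ 4) → (3 ≤ x × x + m ≡ 3 + x) ⊎ x ≡ 4 ⊎ x + m ≡ 9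
    from-gap (inj₁ m≡3)                = inj₁ (subst (_≤ x) m≡3 m≤x , trans (cong (x +_) m≡3) (+-comm x 3))
    from-gap (inj₂ (inj₁ x≡4))         = inj₂ (inj₁ x≡4)
    from-gap (inj₂ (inj₂ (x≡5 , m≡4))) = inj₂ (inj₂ (cong₂ _+_ x≡5 m≡4))

2^r≡3+x⇒3≤r : ∀ r → 3 ≤ x → 2 ^ r ≡ 3 + x → 3 ≤ r
2^r≡3+x⇒3≤r 0 _ ()
2^r≡3+x⇒3≤r 1 _ ()
2^r≡3+x⇒3≤r 2 (s≤s (s≤s (s≤s _))) ()
2^r≡3+x⇒3≤r (suc (suc (suc _))) _ _ = s≤s (s≤s (s≤s z≤n))

2^r≢9 : ∀ r → 2 ^ r ≢ 9
2^r≢9 zero ()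
2^r≢9 (suc r) 2ʳ⁺¹≡9 = from-no (2 ∣? 9) (subst (2 ∣_) 2ʳ⁺¹≡9 (m∣m*n (2 ^ r)))

power-of-two-cases : ∀ r → (3 ≤ x × 2 ^ r ≡ 3 + x) ⊎ x ≡ 4 ⊎ 2 ^ r ≡ 9 →
                     x ≡ 4 ⊎ ∃ λ l → 3 ≤ l × x ≡ 2 ^ l ∸ 3
power-of-two-cases r (inj₁ (3≤x , 2ʳ≡3+x)) = inj₂ (r , 2^r≡3+x⇒3≤r r 3≤x 2ʳ≡3+x , cong (_∸ 3) (sym 2ʳ≡3+x))
power-of-two-cases r (inj₂ (inj₁ x≡4))     = inj₁ x≡4
power-of-two-cases r (inj₂ (inj₂ 2ʳ≡9))    = contradiction 2ʳ≡9 (2^r≢9 r)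

trott₂-a₁ : PositiveCF a → Trott 2 a → a 0 ≡ 1 → a 1 ≡ 4 ⊎ ∃ λ l → 3 ≤ l × a 1 ≡ 2 ^ l ∸ 3
trott₂-a₁ {a} pos trott a₀≡1 with ndigits-bounds ≤-refl (pos 1) | trott₂-bounds pos trott a₀≡1
... | N≤2a₁ , a₁<N | upper , lower =
  power-of-two-cases (ndigits 2 (a 1)) (base₂-arith a₁<N N≤2a₁ upper lower)

trott₃-a₁<2 : PositiveCF a → Trott 3 a → a 0 ≡ 1 → a 1 < 2
trott₃-a₁<2 {a} pos trott a₀≡1 = ≰⇒> λ 2≤a₁ → ⋖-mediant-≰ c₂⋖c₃ (pos 3) (c₄≤c₂ 2≤a₁)
  where
    open FirstQuotientOne a a₀≡1
    M : ℕ
    M = 3 ^ ndigits 3 (a 1)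
    c₂⋖c₃ : p a 2 / q a 2 ⋖ p a 3 / q a 3
    c₂⋖c₃ = proj₁ (convergents-zigzag a 1)
    c₄≤supJ₂ : p a 4 / q a 4 ≤ℚ (V 3 a 2 + 1) / (3 ^ L 3 a 2)
    c₄≤supJ₂ = proj₁ (meets-falling 3 3 2 pos trott (proj₂ (convergents-zigzag a 1)))
    a₁+1≤M : a 1 + 1 ≤ M
    a₁+1≤M = subst (_≤ M) (+-comm 1 (a 1)) (proj₂ (ndigits-bounds (s≤s (s≤s z≤n)) (pos 1)))
    supJ₂≤2/3 : (V 3 a 2 + 1) / (3 ^ L 3 a 2) ≤ℚ 2 / 3
    supJ₂≤2/3 = begin
      (V 3 a 2 + 1) * 3    ≡⟨ cong (λ v → (v + 1) * 3) (V₂≡ 3) ⟩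
      (M + a 1 + 1) * 3    ≡⟨ cong (_* 3) (+-assoc M (a 1) 1) ⟩
      (M + (a 1 + 1)) * 3  ≤⟨ *-monoˡ-≤ 3 (+-monoʳ-≤ M a₁+1≤M) ⟩
      (M + M) * 3          ≡⟨ E₁ M ⟩
      2 * (3 * M)          ≡⟨ cong (2 *_) (sym (bᴸ²≡ (s≤s (s≤s z≤n)))) ⟩
      2 * 3 ^ L 3 a 2      ∎
      where
        open ≤-Reasoning
        E₁ : ∀ M → (M + M) * 3 ≡ 2 * (3 * M)
        E₁ = solve-∀
    2/3≤c₂ : 2 ≤ a 1 → 2 / 3 ≤ℚ p a 2 / q a 2
    2/3≤c₂ 2≤a₁ = begin
      2 * q a 2      ≡⟨ cong (2 *_) q₂≡a₁+1 ⟩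
      2 * (a 1 + 1)  ≡⟨ *-distribˡ-+ 2 (a 1) 1 ⟩
      2 * a 1 + 2    ≤⟨ +-monoʳ-≤ (2 * a 1) 2≤a₁ ⟩
      2 * a 1 + a 1  ≡⟨ E₂ (a 1) ⟩
      a 1 * 3        ≡⟨ cong (_* 3) (sym (p₂≡a₁ a)) ⟩
      p a 2 * 3      ∎
      where
        open ≤-Reasoning
        E₂ : ∀ x → 2 * x + x ≡ x * 3
        E₂ = solve-∀
    c₄≤c₂ : 2 ≤ a 1 → p a 4 / q a 4 ≤ℚ p a 2 / q a 2
    c₄≤c₂ 2≤a₁ = ≤ℚ-trans (p a 4) (q a 4) 2 3 (p a 2) (q a 2) z<s
      (≤ℚ-trans (p a 4) (q a 4) (V 3 a 2 + 1) (3 ^ L 3 a 2) 2 3 (m^n>0 3 (L 3 a 2)) c₄≤supJ₂ supJ₂≤2/3)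
      (2/3≤c₂ 2≤a₁)

lemma6p4 : (a : ℕ → ℕ) → PositiveCF a →
           (Trott 2 a → (a 1 ≡ 4) ⊎ ∃ (λ l → 3 ≤ l × a 1 ≡ 2 ^ l ∸ 3))
           × (Trott 3 a → a 1 ≡ 1)
lemma6p4 a pos = base₂ , base₃
  where
    base₂ : Trott 2 a → (a 1 ≡ 4) ⊎ ∃ (λ l → 3 ≤ l × a 1 ≡ 2 ^ l ∸ 3)
    base₂ trott = trott₂-a₁ pos trott (first-quotient≡1 ≤-refl (s≤s (s≤s z≤n)) pos trott)
    base₃ : Trott 3 a → a 1 ≡ 1
    base₃ trott = ≤-antisym (≤-pred (trott₃-a₁<2 pos trott a₀≡1)) (pos 1)
      where
        a₀≡1 : a 0 ≡ 1
        a₀≡1 = first-quotient≡1 (s≤s (s≤s z≤n)) ≤-refl pos trott
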